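{- Let $p$ be a position in a game with game value $\alpha$ for some player. For any ordinal $\beta\le\alpha$, there is a finite sequence of legal moves that from $p$ reaches some position $q$ with game value $\beta$ for the same player.
   Context: Games: two-player perfect-information games whose game tree is a rooted tree embeddable into $\omega^{<\omega}$ (countable branching, plays of length at most $\omega$); players alternate moves; each player has a set of winning plays (disjoint), other plays are draws; a game is open for a player if every win by that player is decided after finitely many moves. Game value for a player $O$ (opponent $C$), in a game open for $O$: a position at which $O$ has already won (every play through it is a win for $O$) has value $0$; if $O$ is to move and $\alpha$ is the least value among successors having a value, the value is $\alpha+1$; if $C$ is to move and all successors have values, the value is the supremum of these values; positions not assigned a value this way have no value. -}

module Defs where

open import Data.Nat using (ℕ)
open import Data.List using (List; []; _∷_; _++_; _∷ʳ_; length; applyUpTo)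
open import Data.Product using (Σ; ∃; ∃-syntax; _×_; _,_)
open import Data.Empty using (⊥)
open import Relation.Nullary using (¬_)
open import Relation.Binary.PropositionalEquality using (_≡_; _≢_)

-- Countable ordinals as Brouwer trees (values of positions in a
-- countably branching game tree are countable ordinals).

data Ord : Set where
  ozero : Ord
  osuc  : Ord → Ord
  olim  : (ℕ → Ord) → Ord

data _≤ₒ_ : Ord → Ord → Set where
  z≤ₒ   : ∀ {y} → ozero ≤ₒ y
  s≤ₒs  : ∀ {x y} → x ≤ₒ y → osuc x ≤ₒ osuc y
  ≤olim : ∀ {x f} (k : ℕ) → x ≤ₒ f k → x ≤ₒ olim f
  olim≤ : ∀ {f y} → (∀ k → f k ≤ₒ y) → olim f ≤ₒ y

_<ₒ_ : Ord → Ord → Set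
x <ₒ y = osuc x ≤ₒ y

data Player : Set where
  first second : Player

other : Player → Player
other first  = second
other second = first

mover : List ℕ → Player
mover []      = first
mover (_ ∷ p) = other (mover p)

-- Games: trees of positions inside ω^{<ω}; plays are maximal branches
-- (terminal positions, or infinite branches); each player has a set of
-- winning plays, disjoint; other plays are draws.

_⊑_ : List ℕ → List ℕ → Set
p ⊑ q = ∃[ s ] (p ++ s ≡ q)

prefix : (ℕ → ℕ) → ℕ → List ℕ
prefix f k = applyUpTo f k

record Game : Set₁ where
  field
    Pos           : List ℕ → Set
    root          : Pos []
    prefix-closed : ∀ p n → Pos (p ∷ʳ n) → Pos p
    WinFin        : Player → List ℕ → Set
    WinInf        : Player → (ℕ → ℕ) → Set
    disjointFin   : ∀ q → WinFin first q → WinFin second q → ⊥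
    disjointInf   : ∀ f → WinInf first f → WinInf second f → ⊥

module _ (G : Game) where
  open Game G

  Terminal : List ℕ → Set
  Terminal q = Pos q × (∀ n → ¬ Pos (q ∷ʳ n))

  Branch : (ℕ → ℕ) → Set
  Branch f = ∀ k → Pos (prefix f k)

  AlreadyWon : Player → List ℕ → Set
  AlreadyWon O p =
    (∀ q → p ⊑ q → Terminal q → WinFin O q) ×
    (∀ f → Branch f → prefix f (length p) ≡ p → WinInf O f)

  OpenFor : Player → Set
  OpenFor O =
    (∀ q → Terminal q → WinFin O q → ∃[ p ] (p ⊑ q × AlreadyWon O p)) ×
    (∀ f → Branch f → WinInf O f → ∃[ k ] AlreadyWon O (prefix f k))

  -- ValueLE O p α : position p has a game value for O, and it is ≤ α.
  -- (Positive inductive rendering of the paper's recursive definition: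
  --  already won ↦ 0; O to move ↦ (least successor value)+1;
  --  C to move ↦ sup of successor values.)
  data ValueLE (O : Player) : List ℕ → Ord → Set where
    won   : ∀ {p α} → AlreadyWon O p → ValueLE O p α
    oMove : ∀ {p α} → mover p ≡ O → (n : ℕ) → Pos (p ∷ʳ n) →
            (β : Ord) → ValueLE O (p ∷ʳ n) β → β <ₒ α → ValueLE O p α
    cMove : ∀ {p α} → mover p ≢ O →
            (∀ n → Pos (p ∷ʳ n) → ValueLE O (p ∷ʳ n) α) → ValueLE O p α

  HasValue : Player → List ℕ → Ord → Set
  HasValue O p α = ValueLE O p α × (∀ β → β <ₒ α → ¬ ValueLE O p β)

-- Descend from p while keeping the invariant "no value below β". If the
-- current position already has a value ≤ β, that value is exactly β.
-- Otherwise follow the derivation of the value ≤ α: at an O-move go to the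
-- successor that realises it; at a C-move some successor must have no value
-- below β, since if all successors had values < β the position itself would
-- have value ≤ β. The derivation is well founded, so the descent stops.
module Submission where

open import Defs
open import Data.Nat using (ℕ)
open import Data.List using (List; []; _∷_; _++_; _∷ʳ_)
open import Data.List.Properties using (++-identityʳ; ++-assoc)
open import Data.Product using (∃-syntax; _×_; Σ; _,_)
open import Data.Sum using (_⊎_; inj₁; inj₂)
open import Data.Empty using (⊥-elim)
open import Relation.Nullary using (¬_)
open import Relation.Binary.PropositionalEquality using (_≡_; _≢_; sym; subst)

≤ₒ-refl : ∀ x → x ≤ₒ x
≤ₒ-refl ozero    = z≤ₒ
≤ₒ-refl (osuc x) = s≤ₒs (≤ₒ-refl x)
≤ₒ-refl (olim f) = olim≤ λ k → ≤olim k (≤ₒ-refl (f k))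

≤ₒ-trans : ∀ {x y z} → x ≤ₒ y → y ≤ₒ z → x ≤ₒ z
≤ₒ-trans z≤ₒ          _          = z≤ₒ
≤ₒ-trans (olim≤ h)    y≤z        = olim≤ λ k → ≤ₒ-trans (h k) y≤z
≤ₒ-trans (s≤ₒs x≤y)   (s≤ₒs y≤z) = s≤ₒs (≤ₒ-trans x≤y y≤z)
≤ₒ-trans x≤y@(s≤ₒs _) (≤olim k y≤z) = ≤olim k (≤ₒ-trans x≤y y≤z)
≤ₒ-trans (≤olim k x≤y) (olim≤ h)     = ≤ₒ-trans x≤y (h k)
≤ₒ-trans x≤y@(≤olim _ _) (≤olim k y≤z) = ≤olim k (≤ₒ-trans x≤y y≤z)

≤ₒ-step : ∀ {x y} → x ≤ₒ y → x ≤ₒ osuc y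
≤ₒ-step z≤ₒ            = z≤ₒ
≤ₒ-step (s≤ₒs x≤y)     = s≤ₒs (≤ₒ-step x≤y)
≤ₒ-step {y = olim f} (≤olim k x≤fk) =
  ≤ₒ-trans (≤ₒ-step x≤fk) (s≤ₒs (≤olim k (≤ₒ-refl (f k))))
≤ₒ-step (olim≤ h)      = olim≤ λ k → ≤ₒ-step (h k)

<ₒ⇒≤ₒ : ∀ {x y} → x <ₒ y → x ≤ₒ y
<ₒ⇒≤ₒ (s≤ₒs x≤y)    = ≤ₒ-step x≤y
<ₒ⇒≤ₒ (≤olim k x<fk) = ≤olim k (<ₒ⇒≤ₒ x<fk)

module _ (G : Game) (O : Player) where
  open Game G

  ValueLE-mono : ∀ {p α α'} → ValueLE G O p α → α ≤ₒ α' → ValueLE G O p α'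
  ValueLE-mono (won w)               _     = won w
  ValueLE-mono (oMove eq n pn β v β<α) α≤α' = oMove eq n pn β v (≤ₒ-trans β<α α≤α')
  ValueLE-mono (cMove neq vs)        α≤α' = cMove neq λ n pn → ValueLE-mono (vs n pn) α≤α'

  NoValueBelow : List ℕ → Ord → Set
  NoValueBelow p β = ∀ γ → γ <ₒ β → ¬ ValueLE G O p γ

  NoValueBelow-antimono : ∀ {p β β'} → β ≤ₒ β' → NoValueBelow p β' → NoValueBelow p β
  NoValueBelow-antimono β≤β' none γ γ<β = none γ (≤ₒ-trans γ<β β≤β')

  NoValueBelow-oMove : ∀ {p β} → mover p ≡ O → ∀ n → Pos (p ∷ʳ n) →
                       ¬ ValueLE G O p β → NoValueBelow (p ∷ʳ n) β
  NoValueBelow-oMove eq n pn ¬v γ γ<β v = ¬v (oMove eq n pn γ v γ<β)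

  Reaches : List ℕ → Ord → Set
  Reaches p β = ∃[ s ] (Pos (p ++ s) × HasValue G O (p ++ s) β)

  Reaches-here : ∀ {p β} → Pos p → HasValue G O p β → Reaches p β
  Reaches-here {p} {β} pp v =
    [] , subst (λ q → Pos q × HasValue G O q β) (sym (++-identityʳ p)) (pp , v)

  Reaches-∷ʳ : ∀ {p n β} → Reaches (p ∷ʳ n) β → Reaches p β
  Reaches-∷ʳ {p} {n} {β} (s , ps , v) =
    n ∷ s , subst (λ q → Pos q × HasValue G O q β) (++-assoc p (n ∷ []) s) (ps , v)

  module _ (lem : ∀ (P : Set) → P ⊎ ¬ P) where

    NoValueBelow-cMove : ∀ {p β} → mover p ≢ O → ¬ ValueLE G O p β →
                         Σ ℕ λ n → Pos (p ∷ʳ n) × NoValueBelow (p ∷ʳ n) β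
    NoValueBelow-cMove {p} {β} neq ¬v
      with lem (Σ ℕ λ n → Pos (p ∷ʳ n) × NoValueBelow (p ∷ʳ n) β)
    ... | inj₁ succ = succ
    ... | inj₂ ¬succ = ⊥-elim (¬v (cMove neq successorValue))
      where
      successorValue : ∀ n → Pos (p ∷ʳ n) → ValueLE G O (p ∷ʳ n) β
      successorValue n pn with lem (Σ Ord λ γ → γ <ₒ β × ValueLE G O (p ∷ʳ n) γ)
      ... | inj₁ (γ , γ<β , v) = ValueLE-mono v (<ₒ⇒≤ₒ γ<β)
      ... | inj₂ ¬below = ⊥-elim (¬succ (n , pn , λ γ γ<β v → ¬below (γ , γ<β , v)))

    descend : ∀ {p α} β → Pos p → ValueLE G O p α → NoValueBelow p β → Reaches p β
    descend {p} β pp v none with lem (ValueLE G O p β)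
    ... | inj₁ v≤β = Reaches-here pp (v≤β , none)
    descend β pp (won w) none | inj₂ ¬v = ⊥-elim (¬v (won w))
    descend β pp (oMove eq n pn γ v _) none | inj₂ ¬v =
      Reaches-∷ʳ (descend β pn v (NoValueBelow-oMove eq n pn ¬v))
    descend β pp (cMove neq vs) none | inj₂ ¬v
      with NoValueBelow-cMove neq ¬v
    ... | n , pn , none' = Reaches-∷ʳ (descend β pn (vs n pn) none')

-- Openness is not needed: values are only assigned by the inductive ValueLE.
proposition1p17 : (lem : ∀ (P : Set) → P ⊎ ¬ P) →
    (G : Game) (O : Player) → OpenFor G O →
    (p : List ℕ) (α : Ord) → Game.Pos G p → HasValue G O p α →
    (β : Ord) → β ≤ₒ α →
    ∃[ s ] (Game.Pos G (p ++ s) × HasValue G O (p ++ s) β)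
proposition1p17 lem G O _ p α pp (v , none) β β≤α =
  descend G O lem β pp v (NoValueBelow-antimono G O β≤α none)
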